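{- Let $r\ge1$, $\ell\ge1$, and let $\mathcal{C}$ be the set of compositions of $\ell$ into $r$ nonnegative parts. Define $\widetilde P_{0,d}(q)=1$ for $d\in\mathcal{C}$ and, for $n\ge1$, $\widetilde P_{n,d}(q)=\sum_{e}q^{n\Delta(d,e)+nr}\widetilde P_{n-1,e}(q)$, summed over all $e\in\mathcal{C}$ with $e_2+\cdots+e_r\ge2$. Then for every $c\in\mathcal{C}$ and $n\ge0$, $\widetilde P_{n,c}(q)$ is a polynomial with positive coefficients, and \[ \widetilde P_{n,c}(1)=\left(\binom{\ell+r-1}{r-1}-r\right)^n. \]
   Context: For compositions $c=(c_1,\ldots,c_r)$, $d=(d_1,\ldots,d_r)$: $\Delta(c,d)=\sum_{k=2}^r(k-1)(d_k-c_k)+r\max\{0,\ c_r-d_r,\ (c_r+c_{r-1})-(d_r+d_{r-1}),\ \ldots,\ (c_r+\cdots+c_2)-(d_r+\cdots+d_2)\}$ (a nonnegative integer). "Positive coefficients" means all nonzero coefficients are positive. -}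

module Defs where

open import Data.Nat as ℕ using (ℕ; zero; suc; _≤?_)
open import Data.Nat.Combinatorics using (_C_)
open import Data.Integer as ℤ using (ℤ; +_; 0ℤ; 1ℤ; _+_; _-_; _*_; -_; _⊔_; _<_)
open import Data.Fin using (Fin; toℕ)
open import Data.Vec as Vec using (Vec; []; _∷_; lookup)
open import Data.List as List using (List; []; _∷_; map; foldr; filter; concatMap; upTo; allFin)
open import Data.Product using (_×_; _,_; proj₁; proj₂)
open import Relation.Binary.PropositionalEquality using (_≡_; _≢_)
import Data.Integer.Properties as ℤP

∑ℤ : List ℤ → ℤ
∑ℤ = foldr _+_ 0ℤ

-- A (Laurent) polynomial in q with integer coefficients, given as a formal
-- sum of monomials: each pair (k , a) stands for the term a · q^k.
LPoly : Set
LPoly = List (ℤ × ℤ)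

coeff : LPoly → ℤ → ℤ
coeff p k = ∑ℤ (map proj₂ (filter (λ t → proj₁ t ℤ.≟ k) p))

shift : ℤ → LPoly → LPoly
shift m = map (λ t → (m + proj₁ t , proj₂ t))

eval1 : LPoly → ℤ
eval1 p = ∑ℤ (map proj₂ p)

IsPolynomial : LPoly → Set
IsPolynomial p = ∀ k → k < 0ℤ → coeff p k ≡ 0ℤ

PositiveCoeffs : LPoly → Set
PositiveCoeffs p = ∀ k → coeff p k ≢ 0ℤ → 0ℤ < coeff p k

bounded : ℕ → (r : ℕ) → List (Vec ℕ r)
bounded b zero = [] ∷ []
bounded b (suc r) = concatMap (λ x → map (x ∷_) (bounded b r)) (upTo (suc b))

comps : (r ℓ : ℕ) → List (Vec ℕ r)
comps r ℓ = filter (λ v → Vec.sum v ℕ.≟ ℓ) (bounded ℓ r)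

-- Fin-indexing is 0-based: position i (0-based) is entry c_{i+1}.
-- δ c d i = d_{i+1} - c_{i+1}
δ : ∀ {r} → Vec ℕ r → Vec ℕ r → Fin r → ℤ
δ c d i = + lookup d i - + lookup c i

-- Δ(c,d) = Σ_{k=2}^r (k-1)(d_k - c_k)
--          + r · max{0, Σ_{k≥j} (c_k - d_k) for j = r, r-1, …, 2}
Δ : ∀ {r} → Vec ℕ r → Vec ℕ r → ℤ
Δ {r} c d =
  ∑ℤ (map (λ i → + toℕ i * δ c d i) (allFin r))
  + + r * foldr _⊔_ 0ℤ (map suffix (filter (1 ≤?_) (upTo r)))
  where
  -- j is 0-based: the sum c_{j+1}+…+c_r - (d_{j+1}+…+d_r), j ∈ {1,…,r-1}
  suffix : ℕ → ℤ
  suffix j = ∑ℤ (map (λ i → - δ c d i) (filter (λ i → j ≤? toℕ i) (allFin r)))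

tailSum : ∀ {r} → Vec ℕ r → ℕ
tailSum [] = 0
tailSum (_ ∷ v) = Vec.sum v

P̃ : (r ℓ : ℕ) → ℕ → Vec ℕ r → LPoly
P̃ r ℓ zero d = (0ℤ , 1ℤ) ∷ []
P̃ r ℓ (suc n) d =
  concatMap (λ e → shift (+ suc n * Δ d e + + suc n * + r) (P̃ r ℓ n e))
            (filter (λ e → 2 ≤? tailSum e) (comps r ℓ))

-- P̃_{n,c} is a sum of monomials q^k with coefficient 1, one for each chain of admissible
-- compositions e (those with e₂ + ⋯ + e_r ≥ 2), so P̃_{n,c}(1) = Nⁿ for N the number of admissible
-- compositions. Among the C(ℓ+r−1, r−1) compositions of ℓ, exactly one has e₂ + ⋯ + e_r = 0 and
-- r − 1 have e₂ + ⋯ + e_r = 1, so N = C(ℓ+r−1, r−1) − r. All exponents are nonnegative because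
-- Δ(c,d) ≥ 0: by summation by parts the suffix sums Σ_{k>j}(c_k − d_k), 1 ≤ j < r, add up to
-- −Σ_k (k−1)(d_k − c_k), and r times their maximum (with 0) dominates that total.

module Submission where

open import Defs
open import Algebra.Bundles using (CommutativeSemiring)
open import Data.Bool using (true; false; if_then_else_)
open import Data.List using (List; []; _∷_; map; filter; concatMap; applyUpTo; upTo; allFin; length; foldr; _++_)
open import Data.List.Properties using (map-++; map-∘; map-upTo; length-map; length-upTo; length-filter; filter-none)
open import Data.Nat as ℕ using (ℕ; zero; suc; _≤?_; s≤s; s≤s⁻¹; z≤n)
import Data.Nat.Properties as ℕP
open import Data.Vec using (Vec; _∷_)
open import Function using (_∘_)
open import Function.Bundles using (_⇔_; mk⇔)
open import Relation.Nullary using (Dec; does; yes; no)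
open import Relation.Nullary.Decidable using (does-⇔)
open import Relation.Unary using (Decidable)
import Relation.Binary.PropositionalEquality as ≡

admissible : (r ℓ : ℕ) → List (Vec ℕ r)
admissible r ℓ = filter (λ e → 2 ≤? tailSum e) (comps r ℓ)

module ListSum {c ℓ} (R : CommutativeSemiring c ℓ) where
  open CommutativeSemiring R
  open import Algebra.Properties.CommutativeSemigroup +-commutativeSemigroup using (interchange)
  open import Relation.Binary.Reasoning.Setoid setoid

  ∑ : List Carrier → Carrier
  ∑ = foldr _+_ 0#

  [_] : ∀ {p} {P : Set p} → Dec P → Carrier
  [ P? ] = if does P? then 1# else 0#

  module _ {a} {A : Set a} where

    ∑-cong : ∀ {f g : A → Carrier} → (∀ x → f x ≈ g x) → ∀ xs → ∑ (map f xs) ≈ ∑ (map g xs)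
    ∑-cong f≈g []       = refl
    ∑-cong f≈g (x ∷ xs) = +-cong (f≈g x) (∑-cong f≈g xs)

    ∑-+ : ∀ (f g : A → Carrier) xs → ∑ (map (λ x → f x + g x) xs) ≈ ∑ (map f xs) + ∑ (map g xs)
    ∑-+ f g []       = sym (+-identityˡ 0#)
    ∑-+ f g (x ∷ xs) = begin
      (f x + g x) + ∑ (map (λ x → f x + g x) xs)     ≈⟨ +-congˡ (∑-+ f g xs) ⟩
      (f x + g x) + (∑ (map f xs) + ∑ (map g xs))     ≈⟨ interchange _ _ _ _ ⟩
      (f x + ∑ (map f xs)) + (g x + ∑ (map g xs))     ∎

    ∑-*ˡ : ∀ a (f : A → Carrier) xs → ∑ (map (λ x → a * f x) xs) ≈ a * ∑ (map f xs)
    ∑-*ˡ a f []       = sym (zeroʳ a)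
    ∑-*ˡ a f (x ∷ xs) = trans (+-congˡ (∑-*ˡ a f xs)) (sym (distribˡ a (f x) _))

    ∑-filter : ∀ {p} {P : A → Set p} (P? : Decidable P) (f : A → Carrier) xs →
               ∑ (map f (filter P? xs)) ≈ ∑ (map (λ x → [ P? x ] * f x) xs)
    ∑-filter P? f []       = refl
    ∑-filter P? f (x ∷ xs) with does (P? x)
    ... | true  = +-cong (sym (*-identityˡ (f x))) (∑-filter P? f xs)
    ... | false = trans (∑-filter P? f xs) (sym (trans (+-congʳ (zeroˡ (f x))) (+-identityˡ _)))

    ∑-filter-swap : ∀ {b p} {B : Set b} {P : B → A → Set p} (P? : ∀ j → Decidable (P j)) (g : A → Carrier) xs js →
      ∑ (map (λ j → ∑ (map g (filter (P? j) xs))) js) ≈ ∑ (map (λ x → ∑ (map (λ j → [ P? j x ]) js) * g x) xs)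
    ∑-filter-swap P? g xs []       = sym (trans (∑-*ˡ 0# g xs) (zeroˡ _))
    ∑-filter-swap P? g xs (j ∷ js) = begin
      ∑ (map g (filter (P? j) xs)) + ∑ (map (λ j → ∑ (map g (filter (P? j) xs))) js)
        ≈⟨ +-cong (∑-filter (P? j) g xs) (∑-filter-swap P? g xs js) ⟩
      ∑ (map (λ x → [ P? j x ] * g x) xs) + ∑ (map (λ x → ∑ (map (λ j → [ P? j x ]) js) * g x) xs)
        ≈⟨ sym (∑-+ _ _ xs) ⟩
      ∑ (map (λ x → [ P? j x ] * g x + ∑ (map (λ j → [ P? j x ]) js) * g x) xs)
        ≈⟨ ∑-cong (λ x → sym (distribʳ (g x) _ _)) xs ⟩
      ∑ (map (λ x → ∑ (map (λ j → [ P? j x ]) (j ∷ js)) * g x) xs) ∎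

  ∑-++ : ∀ xs ys → ∑ (xs ++ ys) ≈ ∑ xs + ∑ ys
  ∑-++ []       ys = sym (+-identityˡ _)
  ∑-++ (x ∷ xs) ys = trans (+-congˡ (∑-++ xs ys)) (sym (+-assoc x _ _))

  ∑-concatMap : ∀ {a b} {A : Set a} {B : Set b} (f : B → Carrier) (g : A → List B) xs →
                ∑ (map f (concatMap g xs)) ≈ ∑ (map (∑ ∘ map f ∘ g) xs)
  ∑-concatMap f g []       = refl
  ∑-concatMap f g (x ∷ xs) = begin
    ∑ (map f (g x ++ concatMap g xs))            ≡⟨ ≡.cong ∑ (map-++ f (g x) _) ⟩
    ∑ (map f (g x) ++ map f (concatMap g xs))     ≈⟨ ∑-++ (map f (g x)) _ ⟩
    ∑ (map f (g x)) + ∑ (map f (concatMap g xs))  ≈⟨ +-congˡ (∑-concatMap f g xs) ⟩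
    ∑ (map f (g x)) + ∑ (map (∑ ∘ map f ∘ g) xs)  ∎

  ∑-applyUpTo-0# : ∀ n → ∑ (applyUpTo (λ _ → 0#) n) ≈ 0#
  ∑-applyUpTo-0# zero    = refl
  ∑-applyUpTo-0# (suc n) = trans (+-identityˡ _) (∑-applyUpTo-0# n)

  ∑-applyUpTo-cong : ∀ {f g : ℕ → Carrier} → (∀ x → f x ≈ g x) → ∀ n → ∑ (applyUpTo f n) ≈ ∑ (applyUpTo g n)
  ∑-applyUpTo-cong f≈g zero    = refl
  ∑-applyUpTo-cong f≈g (suc n) = +-cong (f≈g 0) (∑-applyUpTo-cong (f≈g ∘ suc) n)

  [s≤s] : ∀ x y → [ suc x ≤? suc y ] ≈ [ x ≤? y ]
  [s≤s] x y = reflexive (≡.cong (λ b → if b then 1# else 0#)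
                                (does-⇔ (mk⇔ s≤s⁻¹ s≤s) (suc x ≤? suc y) (x ≤? y)))

open ≡ using (_≡_; _≢_; refl; sym; trans; cong; cong₂; subst; module ≡-Reasoning)
open ≡-Reasoning

module Counting where
  open import Data.Nat using (_+_; _*_; _∸_; _≤_; _<_; _≟_)
  open import Data.Nat.Combinatorics using (_C_; nCn≡1; nCk+nC[k+1]≡[n+1]C[k+1])
  open import Data.Vec using (sum)

  open ListSum ℕP.+-*-commutativeSemiring

  count : ∀ {a p} {A : Set a} {P : A → Set p} → Decidable P → List A → ℕ
  count P? xs = ∑ (map (λ x → [ P? x ]) xs)

  length≡∑1 : ∀ {a} {A : Set a} (xs : List A) → length xs ≡ ∑ (map (λ _ → 1) xs)
  length≡∑1 []       = refl
  length≡∑1 (x ∷ xs) = cong suc (length≡∑1 xs)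

  length-filter≡count : ∀ {a p} {A : Set a} {P : A → Set p} (P? : Decidable P) xs →
                        length (filter P? xs) ≡ count P? xs
  length-filter≡count P? xs = begin
    length (filter P? xs)                   ≡⟨ length≡∑1 (filter P? xs) ⟩
    ∑ (map (λ _ → 1) (filter P? xs))        ≡⟨ ∑-filter P? (λ _ → 1) xs ⟩
    ∑ (map (λ x → [ P? x ] * 1) xs)         ≡⟨ ∑-cong (λ x → ℕP.*-identityʳ [ P? x ]) xs ⟩
    count P? xs                             ∎

  length≡count-012 : ∀ {a} {A : Set a} (S : A → ℕ) xs →
    length xs ≡ count (λ x → 2 ≤? S x) xs + (count (λ x → S x ≟ 0) xs + count (λ x → S x ≟ 1) xs)
  length≡count-012 S xs = begin
    length xs                                              ≡⟨ length≡∑1 xs ⟩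
    ∑ (map (λ _ → 1) xs)                                   ≡⟨ ∑-cong (indicator-012 ∘ S) xs ⟩
    ∑ (map (λ x → [ 2 ≤? S x ] + ([ S x ≟ 0 ] + [ S x ≟ 1 ])) xs)
      ≡⟨ ∑-+ _ _ xs ⟩
    count (λ x → 2 ≤? S x) xs + ∑ (map (λ x → [ S x ≟ 0 ] + [ S x ≟ 1 ]) xs)
      ≡⟨ cong (count (λ x → 2 ≤? S x) xs +_) (∑-+ _ _ xs) ⟩
    count (λ x → 2 ≤? S x) xs + (count (λ x → S x ≟ 0) xs + count (λ x → S x ≟ 1) xs) ∎
    where
    indicator-012 : ∀ n → 1 ≡ [ 2 ≤? n ] + ([ n ≟ 0 ] + [ n ≟ 1 ])
    indicator-012 zero          = refl
    indicator-012 (suc zero)    = refl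
    indicator-012 (suc (suc n)) = refl

  compCount : ℕ → ℕ → ℕ
  compCount zero    zero    = 1
  compCount zero    (suc s) = 0
  compCount (suc r) s       = ∑ (applyUpTo (λ x → compCount r (s ∸ x)) (suc s))

  compCount-zero-sum : ∀ r → compCount r 0 ≡ 1
  compCount-zero-sum zero    = refl
  compCount-zero-sum (suc r) = trans (ℕP.+-identityʳ _) (compCount-zero-sum r)

  compCount-one-sum : ∀ r → compCount r 1 ≡ r
  compCount-one-sum zero    = refl
  compCount-one-sum (suc r) = begin
    compCount r 1 + (compCount r 0 + 0)
      ≡⟨ cong₂ _+_ (compCount-one-sum r) (trans (ℕP.+-identityʳ _) (compCount-zero-sum r)) ⟩
    r + 1                               ≡⟨ ℕP.+-comm r 1 ⟩
    suc r                               ∎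

  compCount-one-part : ∀ s → compCount 1 s ≡ 1
  compCount-one-part zero    = refl
  compCount-one-part (suc s) = compCount-one-part s

  -- Splitting off the term x = 0 of the defining sum is Pascal's rule.
  compCount≡binomial : ∀ r s → compCount (suc r) s ≡ (s + r) C r
  compCount≡binomial zero    s       = compCount-one-part s
  compCount≡binomial (suc r) zero    = begin
    compCount (suc r) 0 + 0 ≡⟨ ℕP.+-identityʳ _ ⟩
    compCount (suc r) 0     ≡⟨ compCount≡binomial r 0 ⟩
    r C r                   ≡⟨ nCn≡1 r ⟩
    1                       ≡⟨ sym (nCn≡1 (suc r)) ⟩
    suc r C suc r           ∎
  compCount≡binomial (suc r) (suc s) = begin
    compCount (suc r) (suc s) + compCount (suc (suc r)) s
      ≡⟨ cong₂ _+_ (compCount≡binomial r (suc s)) (compCount≡binomial (suc r) s) ⟩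
    (suc s + r) C r + (s + suc r) C suc r
      ≡⟨ cong (λ m → m C r + (s + suc r) C suc r) (sym (ℕP.+-suc s r)) ⟩
    (s + suc r) C r + (s + suc r) C suc r
      ≡⟨ nCk+nC[k+1]≡[n+1]C[k+1] (s + suc r) r ⟩
    suc (s + suc r) C suc r ∎

  [+≟]≡[≤]*[≟∸] : ∀ x y s → [ x + y ≟ s ] ≡ [ x ≤? s ] * [ y ≟ s ∸ x ]
  [+≟]≡[≤]*[≟∸] zero    y s       = sym (ℕP.+-identityʳ _)
  [+≟]≡[≤]*[≟∸] (suc x) y zero    = refl
  [+≟]≡[≤]*[≟∸] (suc x) y (suc s) = trans ([+≟]≡[≤]*[≟∸] x y s) (cong (_* [ y ≟ s ∸ x ]) (sym ([s≤s] x s)))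

  ∑-truncate : ∀ n s (h : ℕ → ℕ) → s < n →
               ∑ (applyUpTo (λ x → [ x ≤? s ] * h x) n) ≡ ∑ (applyUpTo h (suc s))
  ∑-truncate (suc n) zero    h _         = cong₂ _+_ (ℕP.+-identityʳ (h 0)) (∑-applyUpTo-0# n)
  ∑-truncate (suc n) (suc s) h (s≤s s<n) = cong₂ _+_ (ℕP.+-identityʳ (h 0)) (begin
    ∑ (applyUpTo (λ x → [ suc x ≤? suc s ] * h (suc x)) n)
      ≡⟨ ∑-applyUpTo-cong (λ x → cong (_* h (suc x)) ([s≤s] x s)) n ⟩
    ∑ (applyUpTo (λ x → [ x ≤? s ] * h (suc x)) n)
      ≡⟨ ∑-truncate n s (h ∘ suc) s<n ⟩
    ∑ (applyUpTo (h ∘ suc) (suc s)) ∎)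

  ∑-select : ∀ n m a → m < n → ∑ (applyUpTo (λ x → [ x ≟ m ] * a) n) ≡ a
  ∑-select (suc n) zero    a _         = trans (cong₂ _+_ (ℕP.+-identityʳ a) (∑-applyUpTo-0# n)) (ℕP.+-identityʳ a)
  ∑-select (suc n) (suc m) a (s≤s m<n) = ∑-select n m a m<n

  ∑-bounded-suc : ∀ b r (F : Vec ℕ (suc r) → ℕ) →
    ∑ (map F (bounded b (suc r))) ≡ ∑ (map (λ x → ∑ (map (λ v → F (x ∷ v)) (bounded b r))) (upTo (suc b)))
  ∑-bounded-suc b r F = trans (∑-concatMap F (λ x → map (x ∷_) (bounded b r)) (upTo (suc b)))
    (∑-cong (λ x → cong ∑ (sym (map-∘ (bounded b r)))) (upTo (suc b)))

  count-bounded-sum : ∀ b r s → s ≤ b → count (λ v → sum v ≟ s) (bounded b r) ≡ compCount r s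
  count-bounded-sum b zero    zero    _   = refl
  count-bounded-sum b zero    (suc s) _   = refl
  count-bounded-sum b (suc r) s       s≤b = begin
    count (λ v → sum v ≟ s) (bounded b (suc r))
      ≡⟨ ∑-bounded-suc b r (λ v → [ sum v ≟ s ]) ⟩
    ∑ (map (λ x → count (λ v → x + sum v ≟ s) (bounded b r)) (upTo (suc b)))
      ≡⟨ ∑-cong fix-head (upTo (suc b)) ⟩
    ∑ (map (λ x → [ x ≤? s ] * compCount r (s ∸ x)) (upTo (suc b)))
      ≡⟨ cong ∑ (map-upTo _ (suc b)) ⟩
    ∑ (applyUpTo (λ x → [ x ≤? s ] * compCount r (s ∸ x)) (suc b))
      ≡⟨ ∑-truncate (suc b) s (λ x → compCount r (s ∸ x)) (s≤s s≤b) ⟩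
    compCount (suc r) s ∎
    where
    fix-head : ∀ x → count (λ v → x + sum v ≟ s) (bounded b r) ≡ [ x ≤? s ] * compCount r (s ∸ x)
    fix-head x = begin
      count (λ v → x + sum v ≟ s) (bounded b r)
        ≡⟨ ∑-cong (λ v → [+≟]≡[≤]*[≟∸] x (sum v) s) (bounded b r) ⟩
      ∑ (map (λ v → [ x ≤? s ] * [ sum v ≟ s ∸ x ]) (bounded b r))
        ≡⟨ ∑-*ˡ [ x ≤? s ] _ (bounded b r) ⟩
      [ x ≤? s ] * count (λ v → sum v ≟ s ∸ x) (bounded b r)
        ≡⟨ cong ([ x ≤? s ] *_) (count-bounded-sum b r (s ∸ x) (ℕP.≤-trans (ℕP.m∸n≤m s x) s≤b)) ⟩
      [ x ≤? s ] * compCount r (s ∸ x) ∎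

  length-comps : ∀ r ℓ → length (comps (suc r) ℓ) ≡ (ℓ + r) C r
  length-comps r ℓ = begin
    length (comps (suc r) ℓ)                         ≡⟨ length-filter≡count _ (bounded ℓ (suc r)) ⟩
    count (λ v → sum v ≟ ℓ) (bounded ℓ (suc r))      ≡⟨ count-bounded-sum ℓ (suc r) ℓ ℕP.≤-refl ⟩
    compCount (suc r) ℓ                              ≡⟨ compCount≡binomial r ℓ ⟩
    (ℓ + r) C r                                      ∎

  indicator-*-congˡ : ∀ {a a′ b} {A : Set a} {A′ : Set a′} {B : Set b} (A? : Dec A) (A′? : Dec A′) (B? : Dec B) →
                      (B → A ⇔ A′) → [ A? ] * [ B? ] ≡ [ A′? ] * [ B? ]
  indicator-*-congˡ A? A′? (yes b) A⇔A′ = cong (λ t → (if t then 1 else 0) * 1) (does-⇔ (A⇔A′ b) A? A′?)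
  indicator-*-congˡ A? A′? (no _)  _    = trans (ℕP.*-zeroʳ [ A? ]) (sym (ℕP.*-zeroʳ [ A′? ]))

  [+≟]*[≟]≡[≟∸]*[≟] : ∀ {t ℓ} x y → t ≤ ℓ → [ x + y ≟ ℓ ] * [ y ≟ t ] ≡ [ x ≟ ℓ ∸ t ] * [ y ≟ t ]
  [+≟]*[≟]≡[≟∸]*[≟] {t} {ℓ} x y t≤ℓ =
    indicator-*-congˡ (x + y ≟ ℓ) (x ≟ ℓ ∸ t) (y ≟ t) λ { refl → mk⇔ to from }
    where
    to : x + t ≡ ℓ → x ≡ ℓ ∸ t
    to x+t≡ℓ = trans (sym (ℕP.m+n∸n≡m x t)) (cong (_∸ t) x+t≡ℓ)
    from : x ≡ ℓ ∸ t → x + t ≡ ℓ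
    from refl = ℕP.m∸n+n≡m t≤ℓ

  count-comps-tailSum : ∀ r ℓ t → t ≤ ℓ → count (λ e → tailSum e ≟ t) (comps (suc r) ℓ) ≡ compCount r t
  count-comps-tailSum r ℓ t t≤ℓ = begin
    count (λ e → tailSum e ≟ t) (comps (suc r) ℓ)
      ≡⟨ ∑-filter (λ e → sum e ≟ ℓ) (λ e → [ tailSum e ≟ t ]) (bounded ℓ (suc r)) ⟩
    ∑ (map (λ e → [ sum e ≟ ℓ ] * [ tailSum e ≟ t ]) (bounded ℓ (suc r)))
      ≡⟨ ∑-bounded-suc ℓ r (λ e → [ sum e ≟ ℓ ] * [ tailSum e ≟ t ]) ⟩
    ∑ (map (λ x → ∑ (map (λ v → [ x + sum v ≟ ℓ ] * [ sum v ≟ t ]) (bounded ℓ r))) (upTo (suc ℓ)))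
      ≡⟨ ∑-cong fix-head (upTo (suc ℓ)) ⟩
    ∑ (map (λ x → [ x ≟ ℓ ∸ t ] * compCount r t) (upTo (suc ℓ)))
      ≡⟨ cong ∑ (map-upTo _ (suc ℓ)) ⟩
    ∑ (applyUpTo (λ x → [ x ≟ ℓ ∸ t ] * compCount r t) (suc ℓ))
      ≡⟨ ∑-select (suc ℓ) (ℓ ∸ t) (compCount r t) (s≤s (ℕP.m∸n≤m ℓ t)) ⟩
    compCount r t ∎
    where
    fix-head : ∀ x → ∑ (map (λ v → [ x + sum v ≟ ℓ ] * [ sum v ≟ t ]) (bounded ℓ r))
                   ≡ [ x ≟ ℓ ∸ t ] * compCount r t
    fix-head x = begin
      ∑ (map (λ v → [ x + sum v ≟ ℓ ] * [ sum v ≟ t ]) (bounded ℓ r))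
        ≡⟨ ∑-cong (λ v → [+≟]*[≟]≡[≟∸]*[≟] x (sum v) t≤ℓ) (bounded ℓ r) ⟩
      ∑ (map (λ v → [ x ≟ ℓ ∸ t ] * [ sum v ≟ t ]) (bounded ℓ r))
        ≡⟨ ∑-*ˡ [ x ≟ ℓ ∸ t ] _ (bounded ℓ r) ⟩
      [ x ≟ ℓ ∸ t ] * count (λ v → sum v ≟ t) (bounded ℓ r)
        ≡⟨ cong ([ x ≟ ℓ ∸ t ] *_) (count-bounded-sum ℓ r t t≤ℓ) ⟩
      [ x ≟ ℓ ∸ t ] * compCount r t ∎

  length-admissible : ∀ r ℓ → 1 ≤ ℓ → length (admissible (suc r) ℓ) + suc r ≡ (ℓ + r) C r
  length-admissible r ℓ 1≤ℓ = begin
    length (admissible (suc r) ℓ) + suc r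
      ≡⟨ cong₂ _+_ (length-filter≡count _ cs) (sym tails≤1) ⟩
    count (λ e → 2 ≤? tailSum e) cs + (count (λ e → tailSum e ≟ 0) cs + count (λ e → tailSum e ≟ 1) cs)
      ≡⟨ sym (length≡count-012 tailSum cs) ⟩
    length cs
      ≡⟨ length-comps r ℓ ⟩
    (ℓ + r) C r ∎
    where
    cs : List (Vec ℕ (suc r))
    cs = comps (suc r) ℓ
    tails≤1 : count (λ e → tailSum e ≟ 0) cs + count (λ e → tailSum e ≟ 1) cs ≡ suc r
    tails≤1 = cong₂ _+_ (trans (count-comps-tailSum r ℓ 0 z≤n) (compCount-zero-sum r))
                        (trans (count-comps-tailSum r ℓ 1 1≤ℓ) (compCount-one-sum r))

module Polynomials where
  open import Data.Fin using (Fin; toℕ)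
  open import Data.Fin.Properties using (toℕ<n)
  import Data.Integer as ℤ
  open import Data.Integer using (ℤ; +_; 0ℤ; 1ℤ; _+_; _*_; -_; _⊔_; _≤_; _^_; +≤+)
  import Data.Integer.Properties as ℤP
  open import Data.List.Relation.Unary.All as All using (All; []; _∷_)
  import Data.List.Relation.Unary.All.Properties as All
  open import Data.Product using (_×_; _,_; proj₁; proj₂)
  open ListSum ℤP.+-*-commutativeSemiring

  ∑-const : ∀ {a} {A : Set a} c (xs : List A) → ∑ (map (λ _ → c) xs) ≡ + length xs * c
  ∑-const c []       = refl
  ∑-const c (x ∷ xs) = trans (cong (λ s → c + s) (∑-const c xs)) (sym (ℤP.suc-* (+ length xs) c))

  eval1-shift : ∀ m p → eval1 (shift m p) ≡ eval1 p
  eval1-shift m p = cong ∑ (sym (map-∘ p))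

  eval1-P̃ : ∀ r ℓ n d → eval1 (P̃ r ℓ n d) ≡ (+ length (admissible r ℓ)) ^ n
  eval1-P̃ r ℓ zero    d = refl
  eval1-P̃ r ℓ (suc n) d = begin
    eval1 (concatMap (λ e → shift (m e) (P̃ r ℓ n e)) (admissible r ℓ))
      ≡⟨ ∑-concatMap proj₂ (λ e → shift (m e) (P̃ r ℓ n e)) (admissible r ℓ) ⟩
    ∑ (map (λ e → eval1 (shift (m e) (P̃ r ℓ n e))) (admissible r ℓ))
      ≡⟨ ∑-cong (λ e → trans (eval1-shift (m e) (P̃ r ℓ n e)) (eval1-P̃ r ℓ n e)) (admissible r ℓ) ⟩
    ∑ (map (λ _ → (+ length (admissible r ℓ)) ^ n) (admissible r ℓ))
      ≡⟨ ∑-const _ (admissible r ℓ) ⟩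
    (+ length (admissible r ℓ)) ^ suc n ∎
    where
    m : Vec ℕ r → ℤ
    m e = + suc n * Δ d e + + suc n * + r

  ∑-neg : ∀ {a} {A : Set a} (f : A → ℤ) xs → ∑ (map (λ x → - f x) xs) ≡ - ∑ (map f xs)
  ∑-neg f []       = refl
  ∑-neg f (x ∷ xs) = trans (cong (λ s → - f x + s) (∑-neg f xs)) (sym (ℤP.neg-distrib-+ (f x) _))

  max₀ : List ℤ → ℤ
  max₀ = foldr _⊔_ 0ℤ

  0≤max₀ : ∀ ys → 0ℤ ≤ max₀ ys
  0≤max₀ []       = ℤP.≤-refl
  0≤max₀ (y ∷ ys) = ℤP.≤-trans (0≤max₀ ys) (ℤP.i≤j⊔i y _)

  ∑≤length*max₀ : ∀ ys → ∑ ys ≤ + length ys * max₀ ys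
  ∑≤length*max₀ []       = ℤP.≤-refl
  ∑≤length*max₀ (y ∷ ys) = ℤP.≤-trans
    (ℤP.+-mono-≤ (ℤP.i≤i⊔j y M)
                 (ℤP.≤-trans (∑≤length*max₀ ys) (ℤP.*-monoˡ-≤-nonNeg (+ length ys) (ℤP.i≤j⊔i y M))))
    (ℤP.≤-reflexive (sym (ℤP.suc-* (+ length ys) (y ⊔ M))))
    where
    M : ℤ
    M = max₀ ys

  -- Δ c d unfolds to weightedSum (δ c d) + + r * max₀ (map (suffixSum (δ c d)) (suffixStarts r)),
  -- with 0-based indices: entry i of a vector is the paper's (i+1)-st.
  weightedSum : ∀ {r} → (Fin r → ℤ) → ℤ
  weightedSum {r} h = ∑ (map (λ i → + toℕ i * h i) (allFin r))

  suffixSum : ∀ {r} → (Fin r → ℤ) → ℕ → ℤ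
  suffixSum {r} h j = ∑ (map (λ i → - h i) (filter (λ i → j ≤? toℕ i) (allFin r)))

  suffixStarts : ℕ → List ℕ
  suffixStarts r = filter (1 ≤?_) (upTo r)

  ∑-applyUpTo-[suc≤] : ∀ n t → t ℕ.≤ n → ∑ (applyUpTo (λ j → [ suc j ≤? t ]) n) ≡ + t
  ∑-applyUpTo-[suc≤] n       zero    _         = ∑-applyUpTo-0# n
  ∑-applyUpTo-[suc≤] (suc n) (suc t) (s≤s t≤n) =
    cong (λ s → 1ℤ + s) (trans (∑-applyUpTo-cong (λ j → [s≤s] (suc j) t) n) (∑-applyUpTo-[suc≤] n t t≤n))

  count-suffixStarts : ∀ r t → t ℕ.< r → ∑ (map (λ j → [ j ≤? t ]) (suffixStarts r)) ≡ + t
  count-suffixStarts (suc r) t (s≤s t≤r) = begin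
    ∑ (map (λ j → [ j ≤? t ]) (suffixStarts (suc r)))
      ≡⟨ ∑-filter (1 ≤?_) (λ j → [ j ≤? t ]) (upTo (suc r)) ⟩
    ∑ (map (λ j → [ 1 ≤? j ] * [ j ≤? t ]) (upTo (suc r)))
      ≡⟨ cong ∑ (map-upTo (λ j → [ 1 ≤? j ] * [ j ≤? t ]) (suc r)) ⟩
    0ℤ * [ 0 ≤? t ] + ∑ (applyUpTo (λ j → [ 1 ≤? suc j ] * [ suc j ≤? t ]) r)
      ≡⟨ cong₂ _+_ (ℤP.*-zeroˡ [ 0 ≤? t ]) (∑-applyUpTo-cong (λ j → ℤP.*-identityˡ [ suc j ≤? t ]) r) ⟩
    0ℤ + ∑ (applyUpTo (λ j → [ suc j ≤? t ]) r)
      ≡⟨ ℤP.+-identityˡ _ ⟩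
    ∑ (applyUpTo (λ j → [ suc j ≤? t ]) r)
      ≡⟨ ∑-applyUpTo-[suc≤] r t t≤r ⟩
    + t ∎

  -- Summation by parts: the index i is counted once for each suffix start 1 ≤ j ≤ i.
  ∑-suffixSum : ∀ r (h : Fin r → ℤ) → ∑ (map (suffixSum h) (suffixStarts r)) ≡ - weightedSum h
  ∑-suffixSum r h = begin
    ∑ (map (suffixSum h) (suffixStarts r))
      ≡⟨ ∑-filter-swap (λ j i → j ≤? toℕ i) (λ i → - h i) (allFin r) (suffixStarts r) ⟩
    ∑ (map (λ i → ∑ (map (λ j → [ j ≤? toℕ i ]) (suffixStarts r)) * - h i) (allFin r))
      ≡⟨ ∑-cong weight (allFin r) ⟩
    ∑ (map (λ i → - (+ toℕ i * h i)) (allFin r))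
      ≡⟨ ∑-neg (λ i → + toℕ i * h i) (allFin r) ⟩
    - weightedSum h ∎
    where
    weight : ∀ i → ∑ (map (λ j → [ j ≤? toℕ i ]) (suffixStarts r)) * - h i ≡ - (+ toℕ i * h i)
    weight i = trans (cong (_* - h i) (count-suffixStarts r (toℕ i) (toℕ<n i))) (sym (ℤP.neg-distribʳ-* (+ toℕ i) (h i)))

  length-suffixStarts : ∀ r → length (suffixStarts r) ℕ.≤ r
  length-suffixStarts r = subst (length (suffixStarts r) ℕ.≤_) (length-upTo r) (length-filter (1 ≤?_) (upTo r))

  Δ-nonNeg : ∀ {r} (c d : Vec ℕ r) → 0ℤ ≤ Δ c d
  Δ-nonNeg {r} c d = ℤP.≤-trans (ℤP.≤-reflexive 0≡A+∑) (ℤP.+-monoʳ-≤ A ∑≤r*M)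
    where
    h : Fin r → ℤ
    h = δ c d
    A : ℤ
    A = weightedSum h
    ys : List ℤ
    ys = map (suffixSum h) (suffixStarts r)
    M : ℤ
    M = max₀ ys
    0≡A+∑ : 0ℤ ≡ A + ∑ ys
    0≡A+∑ = sym (trans (cong (λ s → A + s) (∑-suffixSum r h)) (ℤP.+-inverseʳ A))
    length-ys≤r : length ys ℕ.≤ r
    length-ys≤r = subst (ℕ._≤ r) (sym (length-map (suffixSum h) (suffixStarts r))) (length-suffixStarts r)
    ∑≤r*M : ∑ ys ≤ + r * M
    ∑≤r*M = ℤP.≤-trans (∑≤length*max₀ ys)
                       (ℤP.*-monoʳ-≤-nonNeg M {{ℤ.nonNegative (0≤max₀ ys)}} (+≤+ length-ys≤r))

  NonNegTerm : ℤ × ℤ → Set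
  NonNegTerm t = 0ℤ ≤ proj₁ t × 0ℤ ≤ proj₂ t

  0≤+* : ∀ k {i} → 0ℤ ≤ i → 0ℤ ≤ + k * i
  0≤+* k {+ m} _ = subst (0ℤ ≤_) (ℤP.pos-* k m) (+≤+ z≤n)

  shift-nonNeg : ∀ {m} p → 0ℤ ≤ m → All NonNegTerm p → All NonNegTerm (shift m p)
  shift-nonNeg p 0≤m = All.map⁺ ∘ All.map (λ (0≤k , 0≤a) → ℤP.+-mono-≤ 0≤m 0≤k , 0≤a)

  P̃-nonNeg : ∀ r ℓ n d → All NonNegTerm (P̃ r ℓ n d)
  P̃-nonNeg r ℓ zero    d = (ℤP.≤-refl , +≤+ z≤n) ∷ []
  P̃-nonNeg r ℓ (suc n) d = All.concat⁺ (All.map⁺ (All.universal term-nonNeg (admissible r ℓ)))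
    where
    term-nonNeg : ∀ e → All NonNegTerm (shift (+ suc n * Δ d e + + suc n * + r) (P̃ r ℓ n e))
    term-nonNeg e = shift-nonNeg (P̃ r ℓ n e) (ℤP.+-mono-≤ (0≤+* (suc n) (Δ-nonNeg d e)) (0≤+* (suc n) (+≤+ z≤n)))
                      (P̃-nonNeg r ℓ n e)

  ∑-nonNeg : ∀ {xs} → All (0ℤ ≤_) xs → 0ℤ ≤ ∑ xs
  ∑-nonNeg []         = ℤP.≤-refl
  ∑-nonNeg (0≤x ∷ 0≤xs) = ℤP.+-mono-≤ 0≤x (∑-nonNeg 0≤xs)

  nonNeg⇒IsPolynomial : ∀ {p} → All NonNegTerm p → IsPolynomial p
  nonNeg⇒IsPolynomial ts k k<0 =
    cong (∑ ∘ map proj₂) (filter-none (λ t → proj₁ t ℤ.≟ k) (All.map exponent≢k ts))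
    where
    exponent≢k : ∀ {t} → NonNegTerm t → proj₁ t ≢ k
    exponent≢k (0≤e , _) e≡k = ℤP.<⇒≱ k<0 (subst (0ℤ ≤_) e≡k 0≤e)

  nonNeg⇒PositiveCoeffs : ∀ {p} → All NonNegTerm p → PositiveCoeffs p
  nonNeg⇒PositiveCoeffs {p} ts k coeff≢0 = ℤP.≤∧≢⇒< 0≤coeff (coeff≢0 ∘ sym)
    where
    0≤coeff : 0ℤ ≤ coeff p k
    0≤coeff = ∑-nonNeg (All.map⁺ (All.filter⁺ (λ t → proj₁ t ℤ.≟ k) (All.map proj₂ ts)))

open import Data.Nat using (_≤_; _∸_; _+_)
open import Data.Nat.Combinatorics using (_C_)
import Data.Integer as ℤ
open import Data.Integer using (+_; _-_; _^_)
import Data.Integer.Properties as ℤP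
open import Data.Vec using (sum)
open import Data.Product using (_×_; _,_)
open Counting using (length-admissible)
open import Data.List.Relation.Unary.All using (All)
open Polynomials using (NonNegTerm; eval1-P̃; P̃-nonNeg; nonNeg⇒IsPolynomial; nonNeg⇒PositiveCoeffs)

+[m+n]-+n≡+m : ∀ m n → + (m + n) - + n ≡ + m
+[m+n]-+n≡+m m n = begin
  + (m + n) - + n     ≡⟨ ℤP.[+m]-[+n]≡m⊖n (m + n) n ⟩
  (m + n) ℤ.⊖ n       ≡⟨ ℤP.⊖-≥ (ℕP.m≤n+m n m) ⟩
  + (m + n ∸ n)       ≡⟨ cong +_ (ℕP.m+n∸n≡m m n) ⟩
  + m                 ∎

corollary14 : (r ℓ : ℕ) → 1 ≤ r → 1 ≤ ℓ → (c : Vec ℕ r) → sum c ≡ ℓ → (n : ℕ) →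
    IsPolynomial (P̃ r ℓ n c) × PositiveCoeffs (P̃ r ℓ n c) ×
    eval1 (P̃ r ℓ n c) ≡ (+ ((ℓ + r ∸ 1) C (r ∸ 1)) - + r) ^ n
corollary14 (suc r) ℓ _ 1≤ℓ c _ n =
  nonNeg⇒IsPolynomial terms , nonNeg⇒PositiveCoeffs terms , (begin
    eval1 (P̃ (suc r) ℓ n c)
      ≡⟨ eval1-P̃ (suc r) ℓ n c ⟩
    (+ N) ^ n
      ≡⟨ cong (_^ n) (sym (+[m+n]-+n≡+m N (suc r))) ⟩
    (+ (N + suc r) - + suc r) ^ n
      ≡⟨ cong (λ m → (+ m - + suc r) ^ n) (length-admissible r ℓ 1≤ℓ) ⟩
    (+ ((ℓ + r) C r) - + suc r) ^ n
      ≡⟨ cong (λ m → (+ (m C r) - + suc r) ^ n) (sym (ℕP.+-∸-assoc ℓ (s≤s z≤n))) ⟩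
    (+ ((ℓ + suc r ∸ 1) C r) - + suc r) ^ n ∎)
  where
  terms : All NonNegTerm (P̃ (suc r) ℓ n c)
  terms = P̃-nonNeg (suc r) ℓ n c
  N : ℕ
  N = length (admissible (suc r) ℓ)
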